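{- There is a ranked alphabet $\Sigma$ and a linear EP$\Sigma$RF-TRS $R$ over $\Sigma$ such that $R$ is not a PRF-TRS.
   Context: A ranked alphabet $\Sigma$ is a finite set of symbols with ranks; $X$ a countable set of variables, $T_\Sigma(X)$ the terms, $T_\Sigma$ the ground terms. A TRS $R$ over $\Sigma$ is a finite set of rules $l\to r$, $l,r\in T_\Sigma(X)$, with every variable of $r$ occurring in $l$; $sign(R)$ is the set of symbols in its rules; linear if no variable occurs twice in any left-hand side or right-hand side. $R^*_\Sigma(L)=\{p\mid q\Rightarrow^*_R p,\ q\in L\}$. A bottom-up tree automaton (bta) over $\Sigma$ is a finite automaton with states (treated as constants), final states, rules $\delta(a_1,\dots,a_n)\to a$ and $a\to a'$, recognizing the ground terms rewriting to a final state; recognizable = recognized by some bta. $R$ is an EP$\Sigma$RF-TRS if for any given finite $L\subseteq T_\Sigma$ one can effectively construct a bta $\mathcal{C}$ over $\Sigma$ with $L(\mathcal{C})=R^*_\Sigma(L)$. $R$ is a PRF-TRS if for every ranked alphabet $\Gamma\supseteq sign(R)$, $R$ regarded as a TRS over $\Gamma$ satisfies: $R^*_\Gamma(L)$ is recognizable for every finite $L\subseteq T_\Gamma$. -}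

module Defs where

open import Data.Nat using (ℕ)
open import Data.Fin using (Fin; toℕ)
open import Data.Product using (Σ; Σ-syntax; _×_; _,_; proj₁; proj₂; ∃-syntax)
open import Data.List using (List; []; _∷_; _++_; map)
open import Data.List.Membership.Propositional using (_∈_)
open import Data.List.Relation.Unary.All as ListAll using ()
open import Data.List.Relation.Unary.Unique.Propositional using (Unique)
open import Data.Vec as Vec using (Vec; []; _∷_; lookup; _[_]≔_)
open import Data.Vec.Relation.Unary.All as VecAll using ()
open import Relation.Binary.Construct.Closure.ReflexiveTransitive using (Star)
open import Relation.Nullary using (¬_)
open import Function.Bundles using (_⇔_)

Symbol : Set
Symbol = ℕ × ℕ

rank : Symbol → ℕ
rank = proj₂

Alphabet : Set
Alphabet = List Symbol

-- Terms.  Variables are indexed by ℕ (the countable set X).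
-- The constructor 'st' provides states of tree automata, treated as
-- constants (as in the paper); terms of T_Σ(X) never contain them.

data Term : Set where
  var  : ℕ → Term
  st   : ℕ → Term
  node : (s : Symbol) → Vec Term (rank s) → Term

data InTX (A : Alphabet) : Term → Set where
  var  : ∀ x → InTX A (var x)
  node : ∀ s ts → s ∈ A → VecAll.All (InTX A) ts → InTX A (node s ts)

data InT (A : Alphabet) : Term → Set where
  node : ∀ s ts → s ∈ A → VecAll.All (InT A) ts → InT A (node s ts)

mutual
  vars : Term → List ℕ
  vars (var x) = x ∷ []
  vars (st q) = []
  vars (node s ts) = varsV ts

  varsV : ∀ {n} → Vec Term n → List ℕ
  varsV [] = []
  varsV (t ∷ ts) = vars t ++ varsV ts

mutual
  syms : Term → List Symbol
  syms (var x) = []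
  syms (st q) = []
  syms (node s ts) = s ∷ symsV ts

  symsV : ∀ {n} → Vec Term n → List Symbol
  symsV [] = []
  symsV (t ∷ ts) = syms t ++ symsV ts

mutual
  subst : (ℕ → Term) → Term → Term
  subst σ (var x) = σ x
  subst σ (st q) = st q
  subst σ (node s ts) = node s (substV σ ts)

  substV : ∀ {n} → (ℕ → Term) → Vec Term n → Vec Term n
  substV σ [] = []
  substV σ (t ∷ ts) = subst σ t ∷ substV σ ts

Rule : Set
Rule = Term × Term

data Step (rules : List Rule) : Term → Term → Set where
  root : ∀ {l r} → (l , r) ∈ rules → (σ : ℕ → Term) →
         Step rules (subst σ l) (subst σ r)
  arg  : ∀ {s} {ts : Vec Term (rank s)} (i : Fin (rank s)) {u} →
         Step rules (lookup ts i) u →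
         Step rules (node s ts) (node s (ts [ i ]≔ u))

Steps : List Rule → Term → Term → Set
Steps rules = Star (Step rules)

WFRule : Alphabet → Rule → Set
WFRule A (l , r) = InTX A l × InTX A r × (∀ x → x ∈ vars r → x ∈ vars l)

record TRS (A : Alphabet) : Set where
  field
    rules : List Rule
    wf    : ListAll.All (WFRule A) rules

open TRS public

Linear : ∀ {A} → TRS A → Set
Linear R = ListAll.All (λ lr → Unique (vars (proj₁ lr)) × Unique (vars (proj₂ lr))) (rules R)

SignIn : ∀ {A} → TRS A → Alphabet → Set
SignIn R Γ = ∀ {l r} → (l , r) ∈ rules R → ∀ s → (s ∈ syms l → s ∈ Γ) × (s ∈ syms r → s ∈ Γ)

Desc : List Rule → List Term → Term → Set
Desc rules L p = ∃[ q ] (q ∈ L × Steps rules q p)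

record BTA (A : Alphabet) : Set where
  field
    nStates : ℕ
    final   : List (Fin nStates)
    δrules  : List (Σ[ s ∈ Symbol ] (s ∈ A × Vec (Fin nStates) (rank s) × Fin nStates))
    εrules  : List (Fin nStates × Fin nStates)

open BTA public

-- the rules of a bta, seen as (ground) rewrite rules with states as constants
btaRules : ∀ {A} → BTA A → List Rule
btaRules C =
  map (λ { (s , _ , qs , q) → node s (Vec.map (λ a → st (toℕ a)) qs) , st (toℕ q) }) (δrules C)
  ++ map (λ { (a , a') → st (toℕ a) , st (toℕ a') }) (εrules C)

Lang : ∀ {A} → BTA A → Term → Set
Lang {A} C t = InT A t × ∃[ q ] (q ∈ final C × Steps (btaRules C) t (st (toℕ q)))

Recognizes : ∀ {A} → BTA A → (Term → Set) → Set
Recognizes C P = ∀ t → Lang C t ⇔ P t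

Recognizable : Alphabet → (Term → Set) → Set
Recognizable A P = Σ[ C ∈ BTA A ] Recognizes C P

FiniteGround : Alphabet → List Term → Set
FiniteGround A L = ListAll.All (InT A) L

EPΣRF : ∀ {A} → TRS A → Set
EPΣRF {A} R = (L : List Term) → FiniteGround A L →
              Σ[ C ∈ BTA A ] Recognizes C (Desc (rules R) L)

PRF : ∀ {A} → TRS A → Set
PRF R = (Γ : Alphabet) → SignIn R Γ →
        (L : List Term) → FiniteGround Γ L →
        Recognizable Γ (Desc (rules R) L)

module Submission where

-- Take Σ₀ = {f, g, c}, all unary, and the single linear rule
--   c(x) → f(c(g(x))).
-- Σ₀ has no constants, hence no ground terms, so over Σ₀ every finite L is
-- empty and the empty automaton recognises R*(L): the TRS is EPΣRF.
-- Over Γ₀ = Σ₀ ∪ {a} however, the descendants of c(a) are exactly the terms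
-- fⁱ(c(gⁱ(a))), which no bottom-up tree automaton recognises:
--   * the weight #f − #g is invariant under the rule, so fⁱ(c(gʲ(a))) is a
--     descendant only when i = j;
--   * an accepting run on fᵏ(x) first rewrites x to a state p and then
--     fᵏ(p) to a final state; by pigeonhole two of the diagonal terms share
--     that middle state, so the automaton also accepts some fⁱ(c(gʲ(a))), i < j.

open import Defs
open import Data.Product using (Σ-syntax; _×_)
open import Relation.Nullary using (¬_)

open import Data.Nat using (ℕ; zero; suc; _<_; z<s)
open import Data.Nat.Properties using (n<1+n; <-irrefl)
open import Data.Fin using (Fin; zero; suc; toℕ; fromℕ<)
open import Data.Fin.Properties using (toℕ<n; toℕ-fromℕ<; pigeonhole)
open import Data.Integer using (ℤ; +_; _+_; _*_; _-_; 0ℤ; 1ℤ; -1ℤ)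
open import Data.Integer.Properties using (+-injective; i-j≡0⇒i≡j)
open import Data.Integer.Tactic.RingSolver using (solve-∀)
open import Data.Product using (∃-syntax; _,_; proj₁; proj₂)
open import Data.Sum using (_⊎_; inj₁; inj₂)
open import Data.Empty using (⊥; ⊥-elim)
open import Data.List using ([]; _∷_; map)
open import Data.List.Membership.Propositional using (_∈_)
open import Data.List.Membership.Propositional.Properties using (∈-++⁻; ∈-map⁻)
open import Data.List.Relation.Unary.Any using (here; there)
open import Data.List.Relation.Unary.All as ListAll using (All; []; _∷_)
open import Data.List.Relation.Unary.AllPairs using ([]; _∷_)
open import Data.Vec as Vec using (Vec; []; _∷_; lookup; _[_]≔_)
open import Data.Vec.Relation.Unary.All using ([]; _∷_) renaming (All to AllV)
open import Relation.Binary.Construct.Closure.ReflexiveTransitive using (ε; _◅_; _◅◅_; gmap)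
open import Relation.Binary.PropositionalEquality as ≡ using (_≡_; _≢_; refl; sym; trans; cong)
open import Function.Bundles using (mk⇔; Equivalence)

unary : ℕ → Term → Term
unary nm t = node (nm , 1) (t ∷ [])

tower : ℕ → ℕ → Term → Term
tower nm zero    t = t
tower nm (suc k) t = unary nm (tower nm k t)

tower-suc : ∀ nm k t → tower nm k (unary nm t) ≡ tower nm (suc k) t
tower-suc nm zero    t = refl
tower-suc nm (suc k) t = cong (unary nm) (tower-suc nm k t)

tower-step : ∀ {rs} nm k {t u} → Step rs t u → Step rs (tower nm k t) (tower nm k u)
tower-step nm zero    s = s
tower-step nm (suc k) s = arg zero (tower-step nm k s)

tower-steps : ∀ {rs} nm k {t u} → Steps rs t u → Steps rs (tower nm k t) (tower nm k u)
tower-steps nm k = gmap (tower nm k) (tower-step nm k)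

tower-ground : ∀ {Γ} nm k {t} → (nm , 1) ∈ Γ → InT Γ t → InT Γ (tower nm k t)
tower-ground nm zero    nm∈Γ t-ground = t-ground
tower-ground nm (suc k) nm∈Γ t-ground = node _ _ nm∈Γ (tower-ground nm k nm∈Γ t-ground ∷ [])

module Weight (w : Symbol → ℤ) where

  mutual
    weight : Term → ℤ
    weight (var x)     = 0ℤ
    weight (st q)      = 0ℤ
    weight (node s ts) = w s + weightV ts

    weightV : ∀ {n} → Vec Term n → ℤ
    weightV []       = 0ℤ
    weightV (t ∷ ts) = weight t + weightV ts

  Balanced : Rule → Set
  Balanced (l , r) = ∀ σ → weight (subst σ l) ≡ weight (subst σ r)

  weightV-update : ∀ {n} (ts : Vec Term n) i u →
                   weight (lookup ts i) ≡ weight u → weightV (ts [ i ]≔ u) ≡ weightV ts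
  weightV-update (t ∷ ts) zero    u eq = cong (λ z → z + weightV ts) (sym eq)
  weightV-update (t ∷ ts) (suc i) u eq = cong (λ z → weight t + z) (weightV-update ts i u eq)

  step-preserves : ∀ {rs t u} → All Balanced rs → Step rs t u → weight t ≡ weight u
  step-preserves balanced (root l→r σ) = ListAll.lookup balanced l→r σ
  step-preserves balanced (arg {s} {ts} i {u} inner) =
    cong (λ z → w s + z) (sym (weightV-update ts i u (step-preserves balanced inner)))

  steps-preserve : ∀ {rs t u} → All Balanced rs → Steps rs t u → weight t ≡ weight u
  steps-preserve balanced ε        = refl
  steps-preserve balanced (s ◅ ss) = trans (step-preserves balanced s) (steps-preserve balanced ss)

  weight-tower : ∀ nm k t → weight (tower nm k t) ≡ + k * w (nm , 1) + weight t
  weight-tower nm zero    t = no-layers (w (nm , 1)) (weight t)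
    where
    no-layers : ∀ v x → x ≡ 0ℤ * v + x
    no-layers = solve-∀
  weight-tower nm (suc k) t = begin
    w (nm , 1) + (weight (tower nm k t) + 0ℤ)
      ≡⟨ cong (λ z → w (nm , 1) + (z + 0ℤ)) (weight-tower nm k t) ⟩
    w (nm , 1) + ((+ k * w (nm , 1) + weight t) + 0ℤ)
      ≡⟨ one-more-layer (w (nm , 1)) (+ k) (weight t) ⟩
    (1ℤ + + k) * w (nm , 1) + weight t ∎
    where
    open ≡.≡-Reasoning
    one-more-layer : ∀ v k x → v + ((k * v + x) + 0ℤ) ≡ (1ℤ + k) * v + x
    one-more-layer = solve-∀

data IsState : Term → Set where
  isState : ∀ p → IsState (st p)

data RuleShape (n : ℕ) : Rule → Set where
  transition : ∀ s (ts : Vec Term (rank s)) (q : Fin n) → AllV IsState ts →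
               RuleShape n (node s ts , st (toℕ q))
  ε-move     : ∀ (p q : Fin n) → RuleShape n (st (toℕ p) , st (toℕ q))

states-are-states : ∀ {n m} (qs : Vec (Fin n) m) → AllV IsState (Vec.map (λ q → st (toℕ q)) qs)
states-are-states []       = []
states-are-states (q ∷ qs) = isState _ ∷ states-are-states qs

subst-states : ∀ σ {m} {ts : Vec Term m} → AllV IsState ts → AllV IsState (substV σ ts)
subst-states σ []                = []
subst-states σ (isState p ∷ ps) = isState p ∷ subst-states σ ps

unary-of-states : ∀ {s nm x} {ts : Vec Term (rank s)} → AllV IsState ts →
                  node s ts ≡ unary nm x → ∃[ p ] x ≡ st p
unary-of-states (isState p ∷ []) refl = p , refl

module Run {A : Alphabet} (C : BTA A) where

  n : ℕ
  n = nStates C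

  ⟦_⟧ : Fin n → Term
  ⟦ q ⟧ = st (toℕ q)

  _⇒*_ : Term → Term → Set
  _⇒*_ = Steps (btaRules C)

  Accepts : Term → Set
  Accepts t = ∃[ q ] (q ∈ final C × t ⇒* ⟦ q ⟧)

  transition-rule : Σ[ s ∈ Symbol ] (s ∈ A × Vec (Fin n) (rank s) × Fin n) → Rule
  transition-rule (s , _ , qs , q) = node s (Vec.map ⟦_⟧ qs) , ⟦ q ⟧

  ε-rule : Fin n × Fin n → Rule
  ε-rule (p , q) = ⟦ p ⟧ , ⟦ q ⟧

  rule-shape : ∀ {lr} → lr ∈ btaRules C → RuleShape n lr
  rule-shape l→r with ∈-++⁻ (map transition-rule (δrules C)) l→r
  ... | inj₁ l→r∈δ with ∈-map⁻ transition-rule l→r∈δ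
  ...   | (s , _ , qs , q) , _ , refl = transition s _ q (states-are-states qs)
  rule-shape l→r | inj₂ l→r∈ε with ∈-map⁻ ε-rule l→r∈ε
  ...   | (p , q) , _ , refl = ε-move p q

  root-argument-is-state : ∀ {l r nm x} → RuleShape n (l , r) → ∀ σ →
                           subst σ l ≡ unary nm x → ∃[ p ] x ≡ st p
  root-argument-is-state (transition s ts q ts-states) σ eq =
    unary-of-states (subst-states σ ts-states) eq
  root-argument-is-state (ε-move p q) σ ()

  unary-step : ∀ {nm x t u} → t ≡ unary nm x → Step (btaRules C) t u →
               (∃[ x' ] (u ≡ unary nm x' × Step (btaRules C) x x')) ⊎ (∃[ p ] x ≡ st p)
  unary-step eq   (root l→r σ)   = inj₂ (root-argument-is-state (rule-shape l→r) σ eq)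
  unary-step refl (arg zero inner) = inj₁ (_ , refl , inner)

  peel : ∀ {nm x w} → unary nm x ⇒* w →
         (∃[ x' ] (w ≡ unary nm x' × x ⇒* x')) ⊎ (∃[ p ] (x ⇒* st p × unary nm (st p) ⇒* w))
  peel ε = inj₁ (_ , refl , ε)
  peel (s ◅ ss) with unary-step refl s
  ... | inj₂ (p , refl)      = inj₂ (p , ε , s ◅ ss)
  ... | inj₁ (x' , refl , s') with peel ss
  ...   | inj₁ (x'' , eq , inside) = inj₁ (x'' , eq , s' ◅ inside)
  ...   | inj₂ (p , inside , outside) = inj₂ (p , s' ◅ inside , outside)

  peel-tower : ∀ nm k {x q} → tower nm k x ⇒* st q →
               ∃[ p ] (x ⇒* st p × tower nm k (st p) ⇒* st q)
  peel-tower nm zero    run = _ , run , ε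
  peel-tower nm (suc k) run with peel run
  ... | inj₁ (_ , () , _)
  ... | inj₂ (p , inside , outside) with peel-tower nm k inside
  ...   | p' , x-run , tower-run = p' , x-run , tower-steps nm 1 tower-run ◅◅ outside

  step-into-state : ∀ {t u p} → Step (btaRules C) t u → u ≡ st p → p < n
  step-into-state (root l→r σ) eq with rule-shape l→r | eq
  ... | transition _ _ q _ | refl = toℕ<n q
  ... | ε-move _ q         | refl = toℕ<n q
  step-into-state (arg _ _) ()

  reached-state-bound : ∀ {t p} → t ⇒* st p → t ≡ st p ⊎ p < n
  reached-state-bound ε        = inj₁ refl
  reached-state-bound (s ◅ ss) with reached-state-bound ss
  ... | inj₁ refl = inj₂ (step-into-state s refl)
  ... | inj₂ p<n  = inj₂ p<n

  ThroughState : ℕ → ℕ → Term → Set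
  ThroughState nm k x = ∃[ p ] (x ⇒* ⟦ p ⟧ × Accepts (tower nm k ⟦ p ⟧))

  through-state : ∀ nm k {x} → (∀ p → x ≢ st p) → Accepts (tower nm k x) → ThroughState nm k x
  through-state nm k not-state (q , q-final , run) with peel-tower nm k run
  ... | p , x-run , tower-run with reached-state-bound x-run
  ...   | inj₁ x≡p = ⊥-elim (not-state p x≡p)
  ...   | inj₂ p<n rewrite sym (toℕ-fromℕ< p<n) =
    fromℕ< p<n , x-run , q , q-final , tower-run

  exchange : ∀ nm i j {x y} (r : ThroughState nm i x) (r' : ThroughState nm j y) →
             proj₁ r ≡ proj₁ r' → Accepts (tower nm i y)
  exchange nm i j (p , _ , q , q-final , tower-run) (_ , y-run , _) refl =
    q , q-final , tower-steps nm i y-run ◅◅ tower-run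

  -- Pigeonhole: among n + 1 split runs two pass through the same state.
  pump-through : ∀ nm (x : ℕ → Term) → (∀ k → ThroughState nm k (x k)) →
                 ∃[ i ] ∃[ j ] (i < j × Accepts (tower nm i (x j)))
  pump-through nm x through with pigeonhole (n<1+n n) (λ k → proj₁ (through (toℕ k)))
  ... | i , j , i<j , same-state =
    toℕ i , toℕ j , i<j , exchange nm (toℕ i) (toℕ j) (through (toℕ i)) (through (toℕ j)) same-state

  pump : ∀ nm (x : ℕ → Term) → (∀ k p → x k ≢ st p) →
         (∀ k → Accepts (tower nm k (x k))) →
         ∃[ i ] ∃[ j ] (i < j × Accepts (tower nm i (x j)))
  pump nm x not-state accepts =
    pump-through nm x (λ k → through-state nm k (not-state k) (accepts k))

no-ground-terms : ∀ {A} → (∀ {s} → s ∈ A → 0 < rank s) → ∀ {t} → ¬ InT A t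
no-ground-terms positive (node s ts s∈A args) = first-argument (positive s∈A) args
  where
  first-argument : ∀ {m} {us : Vec Term m} → 0 < m → AllV (InT _) us → ⊥
  first-argument _ (ground ∷ _) = no-ground-terms positive ground

empty-BTA : ∀ {A} → BTA A
empty-BTA = record { nStates = 0 ; final = [] ; δrules = [] ; εrules = [] }

-- Over an alphabet without ground terms every TRS is EPΣRF: each finite
-- L ⊆ T_A is empty, and so is R*(L).
EPΣRF-without-ground-terms : ∀ {A} → (∀ {t} → ¬ InT A t) → (R : TRS A) → EPΣRF R
EPΣRF-without-ground-terms no-ground R L L-ground =
  empty-BTA , λ t → mk⇔ (λ { (_ , _ , () , _) })
                        (λ { (q , q∈L , _) → ⊥-elim (no-ground (ListAll.lookup L-ground q∈L)) })

f g c : Term → Term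
f = unary 0
g = unary 1
c = unary 2

fᵏ gᵏ : ℕ → Term → Term
fᵏ = tower 0
gᵏ = tower 1

a : Term
a = node (3 , 0) []

Σ₀ Γ₀ : Alphabet
Σ₀ = (0 , 1) ∷ (1 , 1) ∷ (2 , 1) ∷ []
Γ₀ = (0 , 1) ∷ (1 , 1) ∷ (2 , 1) ∷ (3 , 0) ∷ []

rule₀ : Rule
rule₀ = c (var 0) , f (c (g (var 0)))

rule₀-wf : WFRule Σ₀ rule₀
rule₀-wf = node _ _ c∈Σ₀ (var 0 ∷ [])
         , node _ _ f∈Σ₀ (node _ _ c∈Σ₀ (node _ _ g∈Σ₀ (var 0 ∷ []) ∷ []) ∷ [])
         , λ x x∈rhs → x∈rhs
  where
  f∈Σ₀ : (0 , 1) ∈ Σ₀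
  f∈Σ₀ = here refl
  g∈Σ₀ : (1 , 1) ∈ Σ₀
  g∈Σ₀ = there (here refl)
  c∈Σ₀ : (2 , 1) ∈ Σ₀
  c∈Σ₀ = there (there (here refl))

R₀ : TRS Σ₀
R₀ = record { rules = rule₀ ∷ [] ; wf = rule₀-wf ∷ [] }

R₀-linear : Linear R₀
R₀-linear = ([] ∷ [] , [] ∷ []) ∷ []

R₀-EPΣRF : EPΣRF R₀
R₀-EPΣRF = EPΣRF-without-ground-terms (no-ground-terms unary-only) R₀
  where
  unary-only : ∀ {s} → s ∈ Σ₀ → 0 < rank s
  unary-only (here refl)                 = z<s
  unary-only (there (here refl))         = z<s
  unary-only (there (there (here refl))) = z<s

f-minus-g : Symbol → ℤ
f-minus-g (0 , _) = 1ℤ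
f-minus-g (1 , _) = -1ℤ
f-minus-g _       = 0ℤ

open Weight f-minus-g

rule₀-balanced : Balanced rule₀
rule₀-balanced σ = f-cancels-g (weight (σ 0))
  where
  f-cancels-g : ∀ x → 0ℤ + (x + 0ℤ) ≡ 1ℤ + ((0ℤ + ((-1ℤ + (x + 0ℤ)) + 0ℤ)) + 0ℤ)
  f-cancels-g = solve-∀

candidate : ℕ → ℕ → Term
candidate i j = fᵏ i (c (gᵏ j a))

weight-candidate : ∀ i j → weight (candidate i j) ≡ + i - + j
weight-candidate i j = begin
  weight (fᵏ i (c (gᵏ j a)))
    ≡⟨ weight-tower 0 i _ ⟩
  + i * 1ℤ + (0ℤ + (weight (gᵏ j a) + 0ℤ))
    ≡⟨ cong (λ z → + i * 1ℤ + (0ℤ + (z + 0ℤ))) (weight-tower 1 j a) ⟩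
  + i * 1ℤ + (0ℤ + ((+ j * -1ℤ + 0ℤ) + 0ℤ))
    ≡⟨ difference (+ i) (+ j) ⟩
  + i - + j ∎
  where
  open ≡.≡-Reasoning
  difference : ∀ i j → i * 1ℤ + (0ℤ + ((j * -1ℤ + 0ℤ) + 0ℤ)) ≡ i - j
  difference = solve-∀

-- c(a) ⇒* fᵏ(c(gᵏ(a))): apply the rule k times, each time at the c.
diagonal-descendant : ∀ k → Steps (rules R₀) (c a) (candidate k k)
diagonal-descendant zero    = ε
diagonal-descendant (suc k) = diagonal-descendant k ◅◅ (next ◅ ε)
  where
  next : Step (rules R₀) (candidate k k) (candidate (suc k) (suc k))
  next = ≡.subst (Step (rules R₀) (candidate k k)) (tower-suc 0 k (c (gᵏ (suc k) a)))
                 (tower-step 0 k (root (here refl) (λ _ → gᵏ k a)))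

descendant-diagonal : ∀ i j → Steps (rules R₀) (c a) (candidate i j) → i ≡ j
descendant-diagonal i j derivation = +-injective (i-j≡0⇒i≡j (+ i) (+ j) (begin
  + i - + j                  ≡⟨ sym (weight-candidate i j) ⟩
  weight (candidate i j)     ≡⟨ sym (steps-preserve (rule₀-balanced ∷ []) derivation) ⟩
  weight (c a)               ≡⟨⟩
  0ℤ                         ∎))
  where open ≡.≡-Reasoning

R₀-sign-in-Γ₀ : SignIn R₀ Γ₀
R₀-sign-in-Γ₀ (here refl) s = lhs-symbols , rhs-symbols
  where
  lhs-symbols : s ∈ syms (c (var 0)) → s ∈ Γ₀
  lhs-symbols (here refl) = there (there (here refl))
  rhs-symbols : s ∈ syms (f (c (g (var 0)))) → s ∈ Γ₀
  rhs-symbols (here refl)                 = here refl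
  rhs-symbols (there (here refl))         = there (there (here refl))
  rhs-symbols (there (there (here refl))) = there (here refl)

candidate-ground : ∀ i j → InT Γ₀ (candidate i j)
candidate-ground i j =
  tower-ground 0 i (here refl) (tower-ground 2 1 (there (there (here refl)))
    (tower-ground 1 j (there (here refl)) a-ground))
  where
  a-ground : InT Γ₀ a
  a-ground = node _ _ (there (there (there (here refl)))) []

-- Over Γ₀ the descendants of c(a) are { fᵏ(c(gᵏ(a))) | k ∈ ℕ }, which is not
-- recognizable: an automaton accepting all of them pumps to a candidate
-- fⁱ(c(gʲ(a))) with i < j, which is not a descendant.
descendants-not-recognizable : ¬ Recognizable Γ₀ (Desc (rules R₀) (c a ∷ []))
descendants-not-recognizable (C , recognises) =
  off-diagonal (pump 0 (λ j → c (gᵏ j a)) (λ _ _ ()) diagonal-accepted)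
  where
  open Run C

  diagonal-accepted : ∀ k → Accepts (candidate k k)
  diagonal-accepted k =
    proj₂ (Equivalence.from (recognises _) (c a , here refl , diagonal-descendant k))

  off-diagonal : ¬ (∃[ i ] ∃[ j ] (i < j × Accepts (candidate i j)))
  off-diagonal (i , j , i<j , accepted)
    with Equivalence.to (recognises _) (candidate-ground i j , accepted)
  ... | _ , here refl , derivation = <-irrefl (descendant-diagonal i j derivation) i<j

R₀-not-PRF : ¬ PRF R₀
R₀-not-PRF prf =
  descendants-not-recognizable (prf Γ₀ R₀-sign-in-Γ₀ (c a ∷ []) (candidate-ground 0 0 ∷ []))

mainTheorem15 : Σ[ A ∈ Alphabet ] Σ[ R ∈ TRS A ] (Linear R × EPΣRF R × ¬ PRF R)
mainTheorem15 = Σ₀ , R₀ , R₀-linear , R₀-EPΣRF , R₀-not-PRF
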